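{- For every integer $m\geq 2$, the windmill graph $K_5^{(m)}$ is total prime.
   Context: All graphs are finite and simple. For a graph $G$ with vertex set $V$ and edge set $E$, a total prime labeling is a bijection $\ell: V\cup E\to\{1,2,\ldots,|V|+|E|\}$ such that (i) for every pair of adjacent vertices $u,v$, $\gcd(\ell(u),\ell(v))=1$, and (ii) for every vertex $v$ of degree at least 2, the greatest common divisor of the labels $\ell(uv)$ over all edges $uv$ incident to $v$ equals 1. A graph is total prime if it admits a total prime labeling. The windmill graph $K_n^{(m)}$ consists of $m$ copies of the complete graph $K_n$ that share exactly one common vertex and are otherwise vertex-disjoint. -}

module Defs where

open import Data.Nat using (ℕ; suc; _+_; _*_; _≤_)
open import Data.Nat.GCD using (gcd)
open import Data.Fin using (Fin; zero; suc; toℕ; combine; remQuot)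
open import Data.Fin.Properties using (_≟_)
open import Data.Product using (_×_; _,_; proj₁; proj₂)
open import Data.Sum using (_⊎_; inj₁; inj₂)
open import Data.List using (List; filter; allFin; map; length; foldr)
open import Relation.Nullary using (Dec; yes; no)
open import Relation.Nullary.Decidable using (_⊎-dec_)
open import Relation.Binary.PropositionalEquality using (_≡_; _≢_)
open import Function.Bundles using (_⤖_; Bijection)

record Graph : Set where
  field
    nv   : ℕ
    ne   : ℕ
    ends : Fin ne → Fin nv × Fin nv
open Graph public

IsSimple : Graph → Set
IsSimple G =
  ((e : Fin (ne G)) → proj₁ (ends G e) ≢ proj₂ (ends G e)) ×
  ((e f : Fin (ne G)) →
     ((proj₁ (ends G e) ≡ proj₁ (ends G f) × proj₂ (ends G e) ≡ proj₂ (ends G f)) ⊎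
      (proj₁ (ends G e) ≡ proj₂ (ends G f) × proj₂ (ends G e) ≡ proj₁ (ends G f))) →
     e ≡ f)

incident : (G : Graph) → Fin (nv G) → List (Fin (ne G))
incident G v = filter (λ e → (proj₁ (ends G e) ≟ v) ⊎-dec (proj₂ (ends G e) ≟ v)) (allFin (ne G))

degree : (G : Graph) → Fin (nv G) → ℕ
degree G v = length (incident G v)

gcdList : List ℕ → ℕ
gcdList = foldr gcd 0

-- A total prime labeling: a bijection V ⊎ E → {1,…,|V|+|E|}
-- (encoded as Fin (|V|+|E|), with label = toℕ + 1).
record TotalPrimeLabeling (G : Graph) : Set where
  field
    bij : (Fin (nv G) ⊎ Fin (ne G)) ⤖ Fin (nv G + ne G)
  label : Fin (nv G) ⊎ Fin (ne G) → ℕ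
  label x = suc (toℕ (Bijection.to bij x))
  field
    vertexCond : (e : Fin (ne G)) →
      gcd (label (inj₁ (proj₁ (ends G e)))) (label (inj₁ (proj₂ (ends G e)))) ≡ 1
    edgeCond : (v : Fin (nv G)) → 2 ≤ degree G v →
      gcdList (map (λ e → label (inj₂ e)) (incident G v)) ≡ 1

IsTotalPrime : Graph → Set
IsTotalPrime G = TotalPrimeLabeling G

k5edge : Fin 10 → Fin 5 × Fin 5
k5edge zero = (zero , suc zero)
k5edge (suc zero) = (zero , suc (suc zero))
k5edge (suc (suc zero)) = (zero , suc (suc (suc zero)))
k5edge (suc (suc (suc zero))) = (zero , suc (suc (suc (suc zero))))
k5edge (suc (suc (suc (suc zero)))) = (suc zero , suc (suc zero))
k5edge (suc (suc (suc (suc (suc zero))))) = (suc zero , suc (suc (suc zero)))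
k5edge (suc (suc (suc (suc (suc (suc zero)))))) = (suc zero , suc (suc (suc (suc zero))))
k5edge (suc (suc (suc (suc (suc (suc (suc zero))))))) = (suc (suc zero) , suc (suc (suc zero)))
k5edge (suc (suc (suc (suc (suc (suc (suc (suc zero)))))))) = (suc (suc zero) , suc (suc (suc (suc zero))))
k5edge (suc (suc (suc (suc (suc (suc (suc (suc (suc zero))))))))) = (suc (suc (suc zero)) , suc (suc (suc (suc zero))))

-- Windmill K_5^(m): vertex 0 is the shared centre; local vertex (suc k) of
-- copy i is the global vertex suc (combine i k).
windmillVertex : (m : ℕ) → Fin m → Fin 5 → Fin (suc (m * 4))
windmillVertex m i zero = zero
windmillVertex m i (suc k) = suc (combine i k)

windmillK5 : ℕ → Graph
windmillK5 m = record
  { nv = suc (m * 4)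
  ; ne = m * 10
  ; ends = λ e → let (i , j) = remQuot {m} 10 e
                     (a , b) = k5edge j
                 in (windmillVertex m i a , windmillVertex m i b)
  }

{-# OPTIONS --safe #-}
module Submission where

-- The centre gets 1; blade t (counted from 0) gets the six
-- labels 6t+2, …, 6t+7 and the eight consecutive labels 6m+8t+2, …, 6m+8t+9. Its outer vertices take
-- 6t+3, 6t+4, 6t+5, 6t+7: a common divisor of two of them divides their difference 1, 2, 3 or 4,
-- while 6t+3 and 6t+5 are odd and 6t+4 is prime to 3. The eight consecutive labels go to edges so
-- that every outer vertex meets two edges with consecutive labels, and the centre meets the last
-- such edge of blade 0 and the first of blade 1 (this is where m ≥ 2 is needed); two consecutive
-- labels already have gcd 1.

open import Defs
open import Data.Nat using (ℕ; zero; suc; _+_; _*_; _≤_; s≤s)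
open import Data.Nat.Properties using (+-suc; +-assoc; +-comm; +-identityʳ; *-suc; *-distribˡ-+)
open import Data.Nat.Divisibility using (_∣_; ∣-trans; m∣m*n; ∣m+n∣m⇒∣n; ∣1⇒≡1; divides)
open import Data.Nat.GCD using (gcd; gcd[m,n]∣m; gcd[m,n]∣n)
open import Data.Nat.Coprimality as Coprime
  using (Coprime; coprime?; coprime-+; coprime-divisor; 1-coprimeTo; coprime⇒gcd≡1)
open import Data.Fin using (Fin; zero; suc; toℕ; fromℕ; combine; remQuot; join; cast)
open import Data.Fin.Patterns
open import Data.Fin.Properties
  using (+↔⊎; toℕ-cast; cast-involutive; toℕ-↑ˡ; toℕ-↑ʳ; toℕ-combine; toℕ-fromℕ;
         remQuot-combine; combine-remQuot; all?)
  renaming (_≟_ to _≟ᶠ_)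
open import Data.Product using (_×_; _,_; proj₁; proj₂; map₂)
open import Data.Product.Algebra using (×-cong)
open import Data.Sum using (_⊎_; inj₁; inj₂; [_,_])
open import Data.Sum.Algebra using (⊎-cong)
open import Data.Sum.Properties using (≡-dec)
open import Data.Unit using (⊤; tt)
open import Data.List using (_∷_; map)
open import Data.List.Membership.Propositional using (_∈_)
open import Data.List.Membership.Propositional.Properties using (∈-map⁺; ∈-filter⁺; ∈-allFin)
open import Data.List.Relation.Unary.Any using (here; there)
open import Function using (_∘_)
open import Function.Bundles using (Inverse; _↔_; mk↔ₛ′)
open import Function.Properties.Inverse using (↔-refl; ↔-sym; ↔-trans; ↔⇒⤖)
open import Relation.Nullary.Decidable using (from-yes; _⊎-dec_)
open import Relation.Binary.PropositionalEquality using (_≡_; refl; sym; trans; cong; subst; subst₂; module ≡-Reasoning)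
open import Relation.Binary.Definitions using (DecidableEquality)
open ≡-Reasoning

coprime-+-offset : ∀ n r k → Coprime (n + r) k → Coprime (n + r) (n + (r + k))
coprime-+-offset n r k c =
  subst (Coprime (n + r)) (+-assoc n r k) (Coprime.sym (coprime-+ (Coprime.sym c)))

coprime-+-∣ : ∀ {n r k} → k ∣ n → Coprime r k → Coprime (n + r) k
coprime-+-∣ k∣n c (d∣n+r , d∣k) = c (∣m+n∣m⇒∣n d∣n+r (∣-trans d∣k k∣n) , d∣k)

coprime-* : ∀ {a m n} → Coprime a m → Coprime a n → Coprime a (m * n)
coprime-* c₁ c₂ (d∣a , d∣mn) =
  c₂ (d∣a , coprime-divisor (λ (e∣d , e∣m) → c₁ (∣-trans e∣d d∣a , e∣m)) d∣mn)

k5VertexLabel : ℕ → Fin 5 → ℕ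
k5VertexLabel t 0F = 1
k5VertexLabel t 1F = 6 * t + 3
k5VertexLabel t 2F = 6 * t + 4
k5VertexLabel t 3F = 6 * t + 5
k5VertexLabel t 4F = 6 * t + 7

k5VertexLabel-coprime : ∀ t j →
  Coprime (k5VertexLabel t (proj₁ (k5edge j))) (k5VertexLabel t (proj₂ (k5edge j)))
k5VertexLabel-coprime t = pairwise
  where
  coprime-6t+ : ∀ {r k} → k ∣ 6 → Coprime r k → Coprime (6 * t + r) k
  coprime-6t+ k∣6 = coprime-+-∣ (∣-trans k∣6 (m∣m*n t))

  6t+3-odd : Coprime (6 * t + 3) 2
  6t+3-odd = coprime-6t+ (divides 3 refl) (from-yes (coprime? 3 2))

  pairwise : ∀ j → Coprime (k5VertexLabel t (proj₁ (k5edge j))) (k5VertexLabel t (proj₂ (k5edge j)))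
  pairwise 0F = 1-coprimeTo _
  pairwise 1F = 1-coprimeTo _
  pairwise 2F = 1-coprimeTo _
  pairwise 3F = 1-coprimeTo _
  pairwise 4F = coprime-+-offset (6 * t) 3 1 (Coprime.sym (1-coprimeTo _))
  pairwise 5F = coprime-+-offset (6 * t) 3 2 6t+3-odd
  pairwise 6F = coprime-+-offset (6 * t) 3 4 (coprime-* 6t+3-odd 6t+3-odd)
  pairwise 7F = coprime-+-offset (6 * t) 4 1 (Coprime.sym (1-coprimeTo _))
  pairwise 8F = coprime-+-offset (6 * t) 4 3 (coprime-6t+ (divides 2 refl) (from-yes (coprime? 4 3)))
  pairwise 9F = coprime-+-offset (6 * t) 5 2 (coprime-6t+ (divides 3 refl) (from-yes (coprime? 5 2)))

gcdList-∣ : ∀ {x xs} → x ∈ xs → gcdList xs ∣ x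
gcdList-∣ {xs = x ∷ xs} (here refl)  = gcd[m,n]∣m x (gcdList xs)
gcdList-∣ {xs = y ∷ xs} (there x∈xs) = ∣-trans (gcd[m,n]∣n y (gcdList xs)) (gcdList-∣ x∈xs)

gcdList-consecutive : ∀ {x xs} → x ∈ xs → suc x ∈ xs → gcdList xs ≡ 1
gcdList-consecutive {x} {xs} x∈xs sx∈xs =
  ∣1⇒≡1 (∣m+n∣m⇒∣n (subst (gcdList xs ∣_) (+-comm 1 x) (gcdList-∣ sx∈xs)) (gcdList-∣ x∈xs))

Incident : (G : Graph) → Fin (nv G) → Fin (ne G) → Set
Incident G v e = proj₁ (ends G e) ≡ v ⊎ proj₂ (ends G e) ≡ v

∈-incident : ∀ G {v e} → Incident G v e → e ∈ incident G v
∈-incident G {v} {e} =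
  ∈-filter⁺ (λ e → (proj₁ (ends G e) ≟ᶠ v) ⊎-dec (proj₂ (ends G e) ≟ᶠ v)) (∈-allFin e)

gcd-incident-consecutive : ∀ G {v e₁ e₂} (ℓ : Fin (ne G) → ℕ) →
  Incident G v e₁ → Incident G v e₂ → ℓ e₂ ≡ suc (ℓ e₁) →
  gcdList (map ℓ (incident G v)) ≡ 1
gcd-incident-consecutive G ℓ inc₁ inc₂ ℓe₂≡1+ℓe₁ =
  gcdList-consecutive (∈-map⁺ ℓ (∈-incident G inc₁))
                      (subst (_∈ map ℓ (incident G _)) ℓe₂≡1+ℓe₁ (∈-map⁺ ℓ (∈-incident G inc₂)))

toℕ-combine-suc : ∀ {m n} (i : Fin m) {p q : Fin n} →
  toℕ q ≡ suc (toℕ p) → toℕ (combine i q) ≡ suc (toℕ (combine i p))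
toℕ-combine-suc {n = n} i {p} {q} q≡1+p = begin
  toℕ (combine i q)           ≡⟨ toℕ-combine i q ⟩
  n * toℕ i + toℕ q           ≡⟨ cong (n * toℕ i +_) q≡1+p ⟩
  n * toℕ i + suc (toℕ p)     ≡⟨ +-suc (n * toℕ i) (toℕ p) ⟩
  suc (n * toℕ i + toℕ p)     ≡⟨ cong suc (toℕ-combine i p) ⟨
  suc (toℕ (combine i p))     ∎

toℕ-combine-next : ∀ {m n} {i i′ : Fin m} → toℕ i′ ≡ suc (toℕ i) →
  toℕ (combine {n = suc n} i′ zero) ≡ suc (toℕ (combine i (fromℕ n)))
toℕ-combine-next {n = n} {i} {i′} i′≡1+i = begin
  toℕ (combine i′ zero)                  ≡⟨ toℕ-combine i′ zero ⟩
  suc n * toℕ i′ + 0                     ≡⟨ +-identityʳ _ ⟩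
  suc n * toℕ i′                         ≡⟨ cong (suc n *_) i′≡1+i ⟩
  suc n * suc (toℕ i)                    ≡⟨ *-suc (suc n) (toℕ i) ⟩
  suc (n + suc n * toℕ i)                ≡⟨ cong suc (+-comm n _) ⟩
  suc (suc n * toℕ i + n)                ≡⟨ cong (λ k → suc (suc n * toℕ i + k)) (toℕ-fromℕ n) ⟨
  suc (suc n * toℕ i + toℕ (fromℕ n))    ≡⟨ cong suc (toℕ-combine i (fromℕ n)) ⟨
  suc (toℕ (combine i (fromℕ n)))        ∎

cast↔ : ∀ {m n} → m ≡ n → Fin m ↔ Fin n
cast↔ eq = mk↔ₛ′ (cast eq) (cast (sym eq)) (cast-involutive eq (sym eq)) (cast-involutive (sym eq) eq)

inBlock : ∀ {m a b} → Fin m → Fin a ⊎ Fin b → Fin (suc (m * a)) ⊎ Fin (m * b)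
inBlock i (inj₁ k) = inj₁ (suc (combine i k))
inBlock i (inj₂ j) = inj₂ (combine i j)

blocks : ∀ {m a b} → (Fin (suc (m * a)) ⊎ Fin (m * b)) ↔ (⊤ ⊎ Fin m × (Fin a ⊎ Fin b))
blocks {m} {a} {b} = mk↔ₛ′ to from to∘from from∘to
  where
  to : Fin (suc (m * a)) ⊎ Fin (m * b) → ⊤ ⊎ Fin m × (Fin a ⊎ Fin b)
  to (inj₁ zero)    = inj₁ tt
  to (inj₁ (suc k)) = inj₂ (map₂ inj₁ (remQuot a k))
  to (inj₂ j)       = inj₂ (map₂ inj₂ (remQuot b j))

  from : ⊤ ⊎ Fin m × (Fin a ⊎ Fin b) → Fin (suc (m * a)) ⊎ Fin (m * b)
  from (inj₁ tt)      = inj₁ zero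
  from (inj₂ (i , x)) = inBlock i x

  to∘from : ∀ y → to (from y) ≡ y
  to∘from (inj₁ tt)             = refl
  to∘from (inj₂ (i , inj₁ k))   = cong (inj₂ ∘ map₂ inj₁) (remQuot-combine i k)
  to∘from (inj₂ (i , inj₂ j))   = cong (inj₂ ∘ map₂ inj₂) (remQuot-combine i j)

  from∘to : ∀ x → from (to x) ≡ x
  from∘to (inj₁ zero)    = refl
  from∘to (inj₁ (suc k)) = cong (inj₁ ∘ suc) (combine-remQuot {m} a k)
  from∘to (inj₂ j)       = cong inj₂ (combine-remQuot {m} b j)

blockwise : ∀ {m a b c d} → (Fin a ⊎ Fin b) ↔ (Fin c ⊎ Fin d) →
  (Fin (suc (m * a)) ⊎ Fin (m * b)) ↔ (Fin (suc (m * c)) ⊎ Fin (m * d))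
blockwise {m} σ = ↔-trans (blocks {m}) (↔-trans (⊎-cong ↔-refl (×-cong ↔-refl σ)) (↔-sym (blocks {m})))

blockwise-inBlock : ∀ {m a b c d} (σ : (Fin a ⊎ Fin b) ↔ (Fin c ⊎ Fin d)) (i : Fin m) x →
  Inverse.to (blockwise {m} σ) (inBlock i x) ≡ inBlock i (Inverse.to σ x)
blockwise-inBlock {m} σ i x =
  cong (Inverse.to (↔-trans (⊎-cong ↔-refl (×-cong ↔-refl σ)) (↔-sym (blocks {m}))))
       (Inverse.strictlyInverseˡ (blocks {m}) (inj₂ (i , x)))

-- inj₁ k is the outer vertex k+1 of a blade and inj₂ j its edge k5edge j. The outer vertices take
-- the lower slots 1, 2, 3, 5 and the edges 14 and 34 the slots 0 and 4; the other eight edges fill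
-- the upper slots in the order 01 02 03 12 13 23 24 04, so each outer vertex meets two consecutive ones.
bladeLabelling : (Fin 4 ⊎ Fin 10) ↔ (Fin 6 ⊎ Fin 8)
bladeLabelling = mk↔ₛ′ slot unslot slot∘unslot unslot∘slot
  where
  slot : Fin 4 ⊎ Fin 10 → Fin 6 ⊎ Fin 8
  slot (inj₁ 0F) = inj₁ 1F
  slot (inj₁ 1F) = inj₁ 2F
  slot (inj₁ 2F) = inj₁ 3F
  slot (inj₁ 3F) = inj₁ 5F
  slot (inj₂ 0F) = inj₂ 0F
  slot (inj₂ 1F) = inj₂ 1F
  slot (inj₂ 2F) = inj₂ 2F
  slot (inj₂ 3F) = inj₂ 7F
  slot (inj₂ 4F) = inj₂ 3F
  slot (inj₂ 5F) = inj₂ 4F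
  slot (inj₂ 6F) = inj₁ 0F
  slot (inj₂ 7F) = inj₂ 5F
  slot (inj₂ 8F) = inj₂ 6F
  slot (inj₂ 9F) = inj₁ 4F

  unslot : Fin 6 ⊎ Fin 8 → Fin 4 ⊎ Fin 10
  unslot (inj₁ 0F) = inj₂ 6F
  unslot (inj₁ 1F) = inj₁ 0F
  unslot (inj₁ 2F) = inj₁ 1F
  unslot (inj₁ 3F) = inj₁ 2F
  unslot (inj₁ 4F) = inj₂ 9F
  unslot (inj₁ 5F) = inj₁ 3F
  unslot (inj₂ 0F) = inj₂ 0F
  unslot (inj₂ 1F) = inj₂ 1F
  unslot (inj₂ 2F) = inj₂ 2F
  unslot (inj₂ 3F) = inj₂ 4F
  unslot (inj₂ 4F) = inj₂ 5F
  unslot (inj₂ 5F) = inj₂ 7F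
  unslot (inj₂ 6F) = inj₂ 8F
  unslot (inj₂ 7F) = inj₂ 3F

  _≟_ : ∀ {a b} → DecidableEquality (Fin a ⊎ Fin b)
  _≟_ = ≡-dec _≟ᶠ_ _≟ᶠ_

  slot∘unslot : ∀ y → slot (unslot y) ≡ y
  slot∘unslot = [ from-yes (all? (λ l → slot (unslot (inj₁ l)) ≟ inj₁ l))
                , from-yes (all? (λ p → slot (unslot (inj₂ p)) ≟ inj₂ p)) ]

  unslot∘slot : ∀ x → unslot (slot x) ≡ x
  unslot∘slot = [ from-yes (all? (λ k → unslot (slot (inj₁ k)) ≟ inj₁ k))
                , from-yes (all? (λ j → unslot (slot (inj₂ j)) ≟ inj₂ j)) ]

module WindmillLabelling (m : ℕ) where

  G : Graph
  G = windmillK5 m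

  blockSizes : suc (m * 6) + m * 8 ≡ suc (m * 4) + m * 10
  blockSizes = cong suc (trans (sym (*-distribˡ-+ m 6 8)) (*-distribˡ-+ m 4 10))

  labelling : (Fin (suc (m * 4)) ⊎ Fin (m * 10)) ↔ Fin (suc (m * 4) + m * 10)
  labelling = ↔-trans (blockwise {m} bladeLabelling) (↔-trans (↔-sym +↔⊎) (cast↔ blockSizes))

  label : Fin (suc (m * 4)) ⊎ Fin (m * 10) → ℕ
  label x = suc (toℕ (Inverse.to labelling x))

  slotLabel : Fin m → Fin 6 ⊎ Fin 8 → ℕ
  slotLabel i (inj₁ l) = 2 + toℕ (combine i l)
  slotLabel i (inj₂ p) = 2 + (m * 6 + toℕ (combine i p))

  label-inBlock : ∀ i x → label (inBlock i x) ≡ slotLabel i (Inverse.to bladeLabelling x)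
  label-inBlock i x = begin
    suc (toℕ (cast blockSizes (join′ (Inverse.to (blockwise {m} bladeLabelling) (inBlock i x)))))
      ≡⟨ cong suc (toℕ-cast blockSizes _) ⟩
    suc (toℕ (join′ (Inverse.to (blockwise {m} bladeLabelling) (inBlock i x))))
      ≡⟨ cong (suc ∘ toℕ ∘ join′) (blockwise-inBlock bladeLabelling i x) ⟩
    suc (toℕ (join′ (inBlock i (Inverse.to bladeLabelling x))))
      ≡⟨ toℕ-join-inBlock (Inverse.to bladeLabelling x) ⟩
    slotLabel i (Inverse.to bladeLabelling x)
      ∎
    where
    join′ : Fin (suc (m * 6)) ⊎ Fin (m * 8) → Fin (suc (m * 6) + m * 8)
    join′ = join (suc (m * 6)) (m * 8)

    toℕ-join-inBlock : ∀ s → suc (toℕ (join′ (inBlock i s))) ≡ slotLabel i s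
    toℕ-join-inBlock (inj₁ l) = cong (2 +_) (toℕ-↑ˡ (combine i l) (m * 8))
    toℕ-join-inBlock (inj₂ p) = cong (2 +_) (toℕ-↑ʳ (m * 6) (combine i p))

  vertexSlotLabel : ∀ i l → slotLabel i (inj₁ l) ≡ 6 * toℕ i + (2 + toℕ l)
  vertexSlotLabel i l = begin
    2 + toℕ (combine i l)        ≡⟨ cong (2 +_) (toℕ-combine i l) ⟩
    2 + (6 * toℕ i + toℕ l)      ≡⟨ trans (+-suc _ (suc (toℕ l))) (cong suc (+-suc _ (toℕ l))) ⟨
    6 * toℕ i + (2 + toℕ l)      ∎

  edgeSlotLabel-suc : ∀ {i₁ i₂ p₁ p₂} → toℕ (combine i₂ p₂) ≡ suc (toℕ (combine i₁ p₁)) →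
    slotLabel i₂ (inj₂ p₂) ≡ suc (slotLabel i₁ (inj₂ p₁))
  edgeSlotLabel-suc consecutive = cong (2 +_) (trans (cong (m * 6 +_) consecutive) (+-suc (m * 6) _))

  withinBlade : ∀ i {p q : Fin 8} → toℕ q ≡ suc (toℕ p) →
    slotLabel i (inj₂ q) ≡ suc (slotLabel i (inj₂ p))
  withinBlade i q≡1+p = edgeSlotLabel-suc (toℕ-combine-suc i q≡1+p)

  label-windmillVertex : ∀ i a → label (inj₁ (windmillVertex m i a)) ≡ k5VertexLabel (toℕ i) a
  label-windmillVertex i 0F = refl
  label-windmillVertex i 1F = trans (label-inBlock i (inj₁ 0F)) (vertexSlotLabel i 1F)
  label-windmillVertex i 2F = trans (label-inBlock i (inj₁ 1F)) (vertexSlotLabel i 2F)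
  label-windmillVertex i 3F = trans (label-inBlock i (inj₁ 2F)) (vertexSlotLabel i 3F)
  label-windmillVertex i 4F = trans (label-inBlock i (inj₁ 3F)) (vertexSlotLabel i 5F)

  ends-combine : ∀ i j →
    ends G (combine i j) ≡ (windmillVertex m i (proj₁ (k5edge j)) , windmillVertex m i (proj₂ (k5edge j)))
  ends-combine i j =
    cong (λ (i′ , j′) → windmillVertex m i′ (proj₁ (k5edge j′)) , windmillVertex m i′ (proj₂ (k5edge j′)))
         (remQuot-combine i j)

  EndsCoprime : Fin (nv G) × Fin (nv G) → Set
  EndsCoprime (u , w) = Coprime (label (inj₁ u)) (label (inj₁ w))

  endsCoprime-combine : ∀ i j → EndsCoprime (ends G (combine i j))
  endsCoprime-combine i j =
    subst EndsCoprime (sym (ends-combine i j))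
          (subst₂ Coprime (sym (label-windmillVertex i (proj₁ (k5edge j))))
                          (sym (label-windmillVertex i (proj₂ (k5edge j))))
                          (k5VertexLabel-coprime (toℕ i) j))

  endsCoprime : ∀ e → EndsCoprime (ends G e)
  endsCoprime e = subst (EndsCoprime ∘ ends G) (combine-remQuot {m} 10 e) (endsCoprime-combine _ _)

  EdgeGcd : Fin (nv G) → Set
  EdgeGcd v = gcdList (map (label ∘ inj₂) (incident G v)) ≡ 1

  end₁ : ∀ i j → Incident G (windmillVertex m i (proj₁ (k5edge j))) (combine i j)
  end₁ i j = inj₁ (cong proj₁ (ends-combine i j))

  end₂ : ∀ i j → Incident G (windmillVertex m i (proj₂ (k5edge j))) (combine i j)
  end₂ i j = inj₂ (cong proj₂ (ends-combine i j))

  consecutiveEdges : ∀ {v} i₁ j₁ i₂ j₂ →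
    Incident G v (combine i₁ j₁) → Incident G v (combine i₂ j₂) →
    slotLabel i₂ (Inverse.to bladeLabelling (inj₂ j₂))
      ≡ suc (slotLabel i₁ (Inverse.to bladeLabelling (inj₂ j₁))) →
    EdgeGcd v
  consecutiveEdges i₁ j₁ i₂ j₂ inc₁ inc₂ consecutive =
    gcd-incident-consecutive G (label ∘ inj₂) inc₁ inc₂ (begin
      label (inj₂ (combine i₂ j₂))                               ≡⟨ label-inBlock i₂ (inj₂ j₂) ⟩
      slotLabel i₂ (Inverse.to bladeLabelling (inj₂ j₂))         ≡⟨ consecutive ⟩
      suc (slotLabel i₁ (Inverse.to bladeLabelling (inj₂ j₁)))   ≡⟨ cong suc (label-inBlock i₁ (inj₂ j₁)) ⟨
      suc (label (inj₂ (combine i₁ j₁)))                         ∎)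

  edgeGcd-blade : ∀ (i : Fin m) (k : Fin 4) → EdgeGcd (suc (combine i k))
  edgeGcd-blade i 0F = consecutiveEdges i 4F i 5F (end₁ i 4F) (end₁ i 5F) (withinBlade i refl)
  edgeGcd-blade i 1F = consecutiveEdges i 7F i 8F (end₁ i 7F) (end₁ i 8F) (withinBlade i refl)
  edgeGcd-blade i 2F = consecutiveEdges i 5F i 7F (end₂ i 5F) (end₂ i 7F) (withinBlade i refl)
  edgeGcd-blade i 3F = consecutiveEdges i 8F i 3F (end₂ i 8F) (end₂ i 3F) (withinBlade i refl)

  edgeGcd-centre : ∀ {i i′ : Fin m} → toℕ i′ ≡ suc (toℕ i) → EdgeGcd zero
  edgeGcd-centre {i} {i′} i′≡1+i =
    consecutiveEdges i 3F i′ 0F (end₁ i 3F) (end₁ i′ 0F) (edgeSlotLabel-suc (toℕ-combine-next i′≡1+i))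

  edgeGcd : ∀ {i i′ : Fin m} → toℕ i′ ≡ suc (toℕ i) → ∀ v → EdgeGcd v
  edgeGcd i′≡1+i zero    = edgeGcd-centre i′≡1+i
  edgeGcd i′≡1+i (suc w) = subst (EdgeGcd ∘ suc) (combine-remQuot {m} 4 w) (edgeGcd-blade _ _)

mainTheorem9 : (m : ℕ) → 2 ≤ m → IsTotalPrime (windmillK5 m)
mainTheorem9 m (s≤s (s≤s _)) = record
  { bij        = ↔⇒⤖ labelling
  ; vertexCond = coprime⇒gcd≡1 ∘ endsCoprime
  ; edgeCond   = λ v _ → edgeGcd {0F} {1F} refl v
  }
  where open WindmillLabelling m
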